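{- Every skew diagram is a generalized skew diagram. Moreover, there exists a generalized skew diagram which is not a skew diagram.
   Context: A diagram here is a finite set of cells at positions $(r,c)$ with $r,c$ positive integers ($r$ = row from the bottom, $c$ = column), with no ghost cells. Skew diagram: for a weak composition $\alpha=(\alpha_1,\dots,\alpha_n)$, $\mathbb{S}(\alpha)$ is built as follows: left-justify $\alpha_i$ cells in row $i$ for each $i\in[n]$; then for $j$ from $1$ to $n$ with $\alpha_j>0$, take $i<j$ maximal with $\alpha_i>0$ (if it exists), and if $\alpha_i>\alpha_j$, shift all rows $k\ge j$ to the right by $\alpha_i-\alpha_j$ columns; finally shift each row $j\in[n]$ to the right by $|\{i : 1\le i<j,\ \alpha_i=0\}|$ columns. A skew diagram is a diagram of the form $\mathbb{S}(\alpha)$. Generalized skew diagram: a diagram $D$ with no ghost cells whose nonempty rows are $r_1<\dots<r_n$, such that, writing $c_i^+$ (resp. $c_i^-$) for the column of the rightmost (resp. leftmost) cell of row $r_i$: for each $i\in[n]$, $(r_i,\tilde c)\in D$ for all $c_i^-<\tilde c<c_i^+$; and $c_i^+\le c_j^+$ and $c_i^-\le c_j^-$ whenever $i<j$. -}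

module Defs where

open import Data.Nat using (ℕ; zero; suc; _+_; _∸_; _≤_; _<_)
open import Data.Product using (_×_; _,_; ∃-syntax)
open import Data.List using (List; []; _∷_; _++_; map; upTo)
open import Data.List.Membership.Propositional using (_∈_)
open import Data.List.Relation.Unary.All using (All)
open import Function.Bundles using (_⇔_)

-- A cell (r , c): r = row (from the bottom), c = column.
Cell : Set
Cell = ℕ × ℕ

-- A diagram is a finite set of cells, represented by a list of cells
-- (duplicates and order are irrelevant: only membership is used).
Diagram : Set
Diagram = List Cell

-- All cells have positive coordinates (and there are no ghost cells:
-- our representation simply has no ghost cells).
IsDiagram : Diagram → Set
IsDiagram D = All (λ { (r , c) → 1 ≤ r × 1 ≤ c }) D

_≈D_ : Diagram → Diagram → Set
D ≈D E = ∀ x → (x ∈ D) ⇔ (x ∈ E)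

rowCells : ℕ → ℕ → ℕ → List Cell
rowCells r off a = map (λ k → (r , off + suc k)) (upTo a)

-- skewGo r p s z α:
--   r = index of current row,
--   p = α_i for the last i < r with α_i > 0 (0 if none),
--   s = accumulated shift from the "shift rows k ≥ j" steps,
--   z = number of i < r with α_i = 0.
skewGo : ℕ → ℕ → ℕ → ℕ → List ℕ → List Cell
skewGo r p s z []             = []
skewGo r p s z (zero ∷ as)    = skewGo (suc r) p s (suc z) as
skewGo r p s z (suc a ∷ as)   =
  rowCells r (s + (p ∸ suc a) + z) (suc a)
  ++ skewGo (suc r) (suc a) (s + (p ∸ suc a)) z as

𝕊 : List ℕ → Diagram
𝕊 α = skewGo 1 0 0 0 α

IsSkewDiagram : Diagram → Set
IsSkewDiagram D = ∃[ α ] (D ≈D 𝕊 α)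

IsRightmost : Diagram → ℕ → ℕ → Set
IsRightmost D r c = ((r , c) ∈ D) × (∀ c' → (r , c') ∈ D → c' ≤ c)

IsLeftmost : Diagram → ℕ → ℕ → Set
IsLeftmost D r c = ((r , c) ∈ D) × (∀ c' → (r , c') ∈ D → c ≤ c')

IsGeneralizedSkewDiagram : Diagram → Set
IsGeneralizedSkewDiagram D =
  IsDiagram D
  × (∀ r c₁ c₂ c → IsLeftmost D r c₁ → IsRightmost D r c₂ → c₁ < c → c < c₂ → (r , c) ∈ D)
  × (∀ r r' c c' → r < r' → IsRightmost D r c → IsRightmost D r' c' → c ≤ c')
  × (∀ r r' c c' → r < r' → IsLeftmost D r c → IsLeftmost D r' c' → c ≤ c')

-- 𝕊(α) is built from the bottom up: the row of a part αⱼ > 0 is the interval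
-- of αⱼ cells right after an offset, every cell above it lies strictly right
-- of that offset, and every nonempty row above it reaches at least as far
-- right as its last cell.  Stacking such a row under a diagram with convex
-- rows and weakly increasing row ends preserves these properties, so the
-- first part follows by induction on α.  For the second part, the single
-- cell (1,2) is a generalized skew diagram, whereas row 1 of any 𝕊(α) is
-- either empty or contains (1,1).
module Submission where

open import Defs
open import Data.Empty using (⊥-elim)
open import Data.List using ([]; _∷_; _++_)
open import Data.List.Membership.Propositional using (_∈_)
open import Data.List.Membership.Propositional.Properties
  using (∈-map⁺; ∈-map⁻; ∈-upTo⁺; ∈-upTo⁻; ∈-++⁺ˡ; ∈-++⁺ʳ; ∈-++⁻)
open import Data.List.Relation.Unary.All using ([]; _∷_)
open import Data.List.Relation.Unary.Any using (here; there)
open import Data.Nat using (ℕ; zero; suc; _+_; _∸_; _≤_; _<_; z≤n; s≤s)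
open import Data.Nat.Properties
open import Data.Nat.Solver using (module +-*-Solver)
open import Data.Product using (_×_; _,_; proj₁; proj₂; ∃-syntax)
open import Data.Sum using (_⊎_; inj₁; inj₂)
open import Function.Bundles using (Equivalence)
open import Relation.Binary.PropositionalEquality using (_≡_; refl; sym; trans; subst)
open import Relation.Nullary using (¬_)

RowConvex : Diagram → Set
RowConvex D =
  ∀ r c₁ c₂ c → IsLeftmost D r c₁ → IsRightmost D r c₂ → c₁ < c → c < c₂ → (r , c) ∈ D

RightmostMonotone : Diagram → Set
RightmostMonotone D =
  ∀ r r' c c' → r < r' → IsRightmost D r c → IsRightmost D r' c' → c ≤ c'

LeftmostMonotone : Diagram → Set
LeftmostMonotone D =
  ∀ r r' c c' → r < r' → IsLeftmost D r c → IsLeftmost D r' c' → c ≤ c'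

GeneralizedSkewShape : Diagram → Set
GeneralizedSkewShape D = RowConvex D × RightmostMonotone D × LeftmostMonotone D

module _ {D E : Diagram} (D≈E : D ≈D E) where

  private
    to : ∀ {x} → x ∈ D → x ∈ E
    to {x} = Equivalence.to (D≈E x)

    from : ∀ {x} → x ∈ E → x ∈ D
    from {x} = Equivalence.from (D≈E x)

  IsLeftmost-≈D : ∀ {r c} → IsLeftmost D r c → IsLeftmost E r c
  IsLeftmost-≈D (∈D , minimal) = to ∈D , λ c' ∈E → minimal c' (from ∈E)

  IsRightmost-≈D : ∀ {r c} → IsRightmost D r c → IsRightmost E r c
  IsRightmost-≈D (∈D , maximal) = to ∈D , λ c' ∈E → maximal c' (from ∈E)

  GeneralizedSkewShape-≈D : GeneralizedSkewShape E → GeneralizedSkewShape D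
  GeneralizedSkewShape-≈D (convex , rightmost-mono , leftmost-mono) =
      (λ r c₁ c₂ c lm rm c₁<c c<c₂ →
         from (convex r c₁ c₂ c (IsLeftmost-≈D lm) (IsRightmost-≈D rm) c₁<c c<c₂))
    , (λ r r' c c' r<r' rm rm' →
         rightmost-mono r r' c c' r<r' (IsRightmost-≈D rm) (IsRightmost-≈D rm'))
    , (λ r r' c c' r<r' lm lm' →
         leftmost-mono r r' c c' r<r' (IsLeftmost-≈D lm) (IsLeftmost-≈D lm'))

GeneralizedSkewShape-[] : GeneralizedSkewShape []
GeneralizedSkewShape-[] =
    (λ { _ _ _ _ (() , _) })
  , (λ { _ _ _ _ _ (() , _) })
  , (λ { _ _ _ _ _ (() , _) })

GeneralizedSkewShape-singleton : ∀ r c → GeneralizedSkewShape ((r , c) ∷ [])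
GeneralizedSkewShape-singleton r c =
    (λ { _ _ _ _ (here refl , _) (here refl , _) c<c' c'<c → ⊥-elim (<-asym c<c' c'<c)
       ; _ _ _ _ (there () , _) _ _ _
       ; _ _ _ _ _ (there () , _) _ _ })
  , (λ { _ _ _ _ r<r (here refl , _) (here refl , _) → ⊥-elim (n≮n r r<r)
       ; _ _ _ _ _ (there () , _) _
       ; _ _ _ _ _ _ (there () , _) })
  , (λ { _ _ _ _ r<r (here refl , _) (here refl , _) → ⊥-elim (n≮n r r<r)
       ; _ _ _ _ _ (there () , _) _
       ; _ _ _ _ _ _ (there () , _) })

module RowBelow {r : ℕ} {R T : Diagram}
  (R-in-row : ∀ {r' c} → (r' , c) ∈ R → r' ≡ r)
  (T-above  : ∀ {r' c} → (r' , c) ∈ T → r < r')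
  where

  row-cases : ∀ {r' c} → (r' , c) ∈ R ++ T → r' ≡ r ⊎ r < r'
  row-cases ∈R++T with ∈-++⁻ R ∈R++T
  ... | inj₁ ∈R = inj₁ (R-in-row ∈R)
  ... | inj₂ ∈T = inj₂ (T-above ∈T)

  ∈-row : ∀ {c} → (r , c) ∈ R ++ T → (r , c) ∈ R
  ∈-row ∈R++T with ∈-++⁻ R ∈R++T
  ... | inj₁ ∈R = ∈R
  ... | inj₂ ∈T = ⊥-elim (n≮n r (T-above ∈T))

  ∈-above : ∀ {r' c} → r < r' → (r' , c) ∈ R ++ T → (r' , c) ∈ T
  ∈-above r<r' ∈R++T with ∈-++⁻ R ∈R++T
  ... | inj₁ ∈R = ⊥-elim (<-irrefl (sym (R-in-row ∈R)) r<r')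
  ... | inj₂ ∈T = ∈T

  IsLeftmost-above : ∀ {r' c} → r < r' → IsLeftmost (R ++ T) r' c → IsLeftmost T r' c
  IsLeftmost-above r<r' (∈R++T , minimal) =
    ∈-above r<r' ∈R++T , λ c' ∈T → minimal c' (∈-++⁺ʳ R ∈T)

  IsRightmost-above : ∀ {r' c} → r < r' → IsRightmost (R ++ T) r' c → IsRightmost T r' c
  IsRightmost-above r<r' (∈R++T , maximal) =
    ∈-above r<r' ∈R++T , λ c' ∈T → maximal c' (∈-++⁺ʳ R ∈T)

  RowConvex-++ :
    (∀ {c₁ c₂ c} → (r , c₁) ∈ R → (r , c₂) ∈ R → c₁ < c → c < c₂ → (r , c) ∈ R) →
    RowConvex T → RowConvex (R ++ T)
  RowConvex-++ R-convex T-convex r' c₁ c₂ c lm rm c₁<c c<c₂ with row-cases (proj₁ lm)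
  ... | inj₁ refl = ∈-++⁺ˡ (R-convex (∈-row (proj₁ lm)) (∈-row (proj₁ rm)) c₁<c c<c₂)
  ... | inj₂ r<r' = ∈-++⁺ʳ R
    (T-convex r' c₁ c₂ c (IsLeftmost-above r<r' lm) (IsRightmost-above r<r' rm) c₁<c c<c₂)

  RightmostMonotone-++ :
    (∀ {c r' c'} → (r , c) ∈ R → (r' , c') ∈ T → ∃[ c'' ] ((r' , c'') ∈ T × c ≤ c'')) →
    RightmostMonotone T → RightmostMonotone (R ++ T)
  RightmostMonotone-++ T-reaches T-mono r₁ r₂ c₁ c₂ r₁<r₂ rm₁ rm₂ with row-cases (proj₁ rm₁)
  ... | inj₁ refl with T-reaches (∈-row (proj₁ rm₁)) (∈-above r₁<r₂ (proj₁ rm₂))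
  ...   | c'' , ∈T , c₁≤c'' = ≤-trans c₁≤c'' (proj₂ rm₂ c'' (∈-++⁺ʳ R ∈T))
  RightmostMonotone-++ T-reaches T-mono r₁ r₂ c₁ c₂ r₁<r₂ rm₁ rm₂ | inj₂ r<r₁ =
    T-mono r₁ r₂ c₁ c₂ r₁<r₂
      (IsRightmost-above r<r₁ rm₁) (IsRightmost-above (<-trans r<r₁ r₁<r₂) rm₂)

  LeftmostMonotone-++ :
    (∀ {r' c'} → (r' , c') ∈ T → ∃[ c ] ((r , c) ∈ R × c ≤ c')) →
    LeftmostMonotone T → LeftmostMonotone (R ++ T)
  LeftmostMonotone-++ R-undercuts T-mono r₁ r₂ c₁ c₂ r₁<r₂ lm₁ lm₂ with row-cases (proj₁ lm₁)
  ... | inj₁ refl with R-undercuts (∈-above r₁<r₂ (proj₁ lm₂))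
  ...   | c , ∈R , c≤c₂ = ≤-trans (proj₂ lm₁ c (∈-++⁺ˡ ∈R)) c≤c₂
  LeftmostMonotone-++ R-undercuts T-mono r₁ r₂ c₁ c₂ r₁<r₂ lm₁ lm₂ | inj₂ r<r₁ =
    T-mono r₁ r₂ c₁ c₂ r₁<r₂
      (IsLeftmost-above r<r₁ lm₁) (IsLeftmost-above (<-trans r<r₁ r₁<r₂) lm₂)

∈-rowCells⁻ : ∀ {r off a r' c} → (r' , c) ∈ rowCells r off a → r' ≡ r × off < c × c ≤ off + a
∈-rowCells⁻ {r} {off} ∈row with ∈-map⁻ (λ k → (r , off + suc k)) ∈row
... | k , k∈ , refl = refl , m<m+n off (s≤s z≤n) , +-monoʳ-≤ off (∈-upTo⁻ k∈)

∈-rowCells⁺ : ∀ {r off a c} → off < c → c ≤ off + a → (r , c) ∈ rowCells r off a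
∈-rowCells⁺ {r} {off} {a} {c} off<c c≤off+a =
  subst (λ c' → (r , c') ∈ rowCells r off a) off+1+k≡c
    (∈-map⁺ (λ k → (r , off + suc k)) (∈-upTo⁺ k<a))
  where
  k : ℕ
  k = c ∸ suc off
  off+1+k≡c : off + suc k ≡ c
  off+1+k≡c = trans (+-suc off k) (m+[n∸m]≡n off<c)
  k<a : k < a
  k<a = +-cancelˡ-≤ off (suc k) a (subst (_≤ off + a) (sym off+1+k≡c) c≤off+a)

rowCells-first : ∀ {r off a} → (r , suc off) ∈ rowCells r off (suc a)
rowCells-first {off = off} = ∈-rowCells⁺ ≤-refl (m<m+n off (s≤s z≤n))

rowCells-last : ∀ {r off a} → (r , off + suc a) ∈ rowCells r off (suc a)
rowCells-last {off = off} = ∈-rowCells⁺ (m<m+n off (s≤s z≤n)) ≤-refl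

rowCells-convex : ∀ {r off a c₁ c₂ c} →
  (r , c₁) ∈ rowCells r off a → (r , c₂) ∈ rowCells r off a → c₁ < c → c < c₂ →
  (r , c) ∈ rowCells r off a
rowCells-convex ∈₁ ∈₂ c₁<c c<c₂ =
  ∈-rowCells⁺ (<-trans (proj₁ (proj₂ (∈-rowCells⁻ ∈₁))) c₁<c)
              (≤-trans (<⇒≤ c<c₂) (proj₂ (proj₂ (∈-rowCells⁻ ∈₂))))

rowOffset : ℕ → ℕ → ℕ → ℕ → ℕ
rowOffset p s z a = s + (p ∸ a) + z

s+z≤rowOffset : ∀ p s z a → s + z ≤ rowOffset p s z a
s+z≤rowOffset p s z a = +-monoˡ-≤ z (m≤m+n s (p ∸ a))

s+z+p≤rowOffset+a : ∀ p s z a → s + z + p ≤ rowOffset p s z a + a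
s+z+p≤rowOffset+a p s z a = begin
  s + z + p              ≤⟨ +-monoʳ-≤ (s + z) (m≤n+m∸n p a) ⟩
  s + z + (a + (p ∸ a))  ≡⟨ rearrange s z (p ∸ a) a ⟩
  s + (p ∸ a) + z + a    ∎
  where
  open ≤-Reasoning
  open +-*-Solver
  rearrange : ∀ s z d a → s + z + (a + d) ≡ s + d + z + a
  rearrange = solve 4 (λ s z d a → s :+ z :+ (a :+ d) := s :+ d :+ z :+ a) refl

skewGo-row≥ : ∀ r p s z as {r' c} → (r' , c) ∈ skewGo r p s z as → r ≤ r'
skewGo-row≥ r p s z (zero ∷ as) ∈T = <⇒≤ (skewGo-row≥ (suc r) p s (suc z) as ∈T)
skewGo-row≥ r p s z (suc a ∷ as) ∈T
  with ∈-++⁻ (rowCells r (rowOffset p s z (suc a)) (suc a)) ∈T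
... | inj₁ ∈row  = ≤-reflexive (sym (proj₁ (∈-rowCells⁻ ∈row)))
... | inj₂ ∈rest = <⇒≤ (skewGo-row≥ (suc r) (suc a) _ z as ∈rest)

skewGo-column> : ∀ r p s z as {r' c} → (r' , c) ∈ skewGo r p s z as → s + z < c
skewGo-column> r p s z (zero ∷ as) ∈T =
  ≤-<-trans (+-monoʳ-≤ s (n≤1+n z)) (skewGo-column> (suc r) p s (suc z) as ∈T)
skewGo-column> r p s z (suc a ∷ as) ∈T
  with ∈-++⁻ (rowCells r (rowOffset p s z (suc a)) (suc a)) ∈T
... | inj₁ ∈row  =
  ≤-<-trans (s+z≤rowOffset p s z (suc a)) (proj₁ (proj₂ (∈-rowCells⁻ ∈row)))
... | inj₂ ∈rest =
  ≤-<-trans (s+z≤rowOffset p s z (suc a)) (skewGo-column> (suc r) (suc a) _ z as ∈rest)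

skewGo-reaches : ∀ r p s z as {r' c} → (r' , c) ∈ skewGo r p s z as →
  ∃[ c' ] ((r' , c') ∈ skewGo r p s z as × s + z + p ≤ c')
skewGo-reaches r p s z (zero ∷ as) ∈T with skewGo-reaches (suc r) p s (suc z) as ∈T
... | c' , ∈T' , bound = c' , ∈T' , ≤-trans (+-monoˡ-≤ p (+-monoʳ-≤ s (n≤1+n z))) bound
skewGo-reaches r p s z (suc a ∷ as) ∈T
  with ∈-++⁻ (rowCells r (rowOffset p s z (suc a)) (suc a)) ∈T
... | inj₁ ∈row with ∈-rowCells⁻ ∈row
...   | refl , _ =
  rowOffset p s z (suc a) + suc a , ∈-++⁺ˡ rowCells-last , s+z+p≤rowOffset+a p s z (suc a)
skewGo-reaches r p s z (suc a ∷ as) ∈T | inj₂ ∈rest with skewGo-reaches (suc r) (suc a) _ z as ∈rest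
... | c' , ∈rest' , bound =
  c' , ∈-++⁺ʳ (rowCells r (rowOffset p s z (suc a)) (suc a)) ∈rest' ,
  ≤-trans (s+z+p≤rowOffset+a p s z (suc a)) bound

skewGo-shape : ∀ r p s z as → GeneralizedSkewShape (skewGo r p s z as)
skewGo-shape r p s z [] = GeneralizedSkewShape-[]
skewGo-shape r p s z (zero ∷ as) = skewGo-shape (suc r) p s (suc z) as
skewGo-shape r p s z (suc a ∷ as) with skewGo-shape (suc r) (suc a) (s + (p ∸ suc a)) z as
... | convex , rightmost-mono , leftmost-mono =
    RowConvex-++ rowCells-convex convex
  , RightmostMonotone-++ rest-reaches rightmost-mono
  , LeftmostMonotone-++ row-undercuts leftmost-mono
  where
  off : ℕ
  off = rowOffset p s z (suc a)
  rest : Diagram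
  rest = skewGo (suc r) (suc a) (s + (p ∸ suc a)) z as
  open RowBelow {r} {rowCells r off (suc a)} {rest}
    (λ ∈row → proj₁ (∈-rowCells⁻ ∈row)) (skewGo-row≥ (suc r) (suc a) _ z as)

  rest-reaches : ∀ {c r' c'} → (r , c) ∈ rowCells r off (suc a) → (r' , c') ∈ rest →
    ∃[ c'' ] ((r' , c'') ∈ rest × c ≤ c'')
  rest-reaches ∈row ∈rest with skewGo-reaches (suc r) (suc a) _ z as ∈rest
  ... | c'' , ∈rest' , bound = c'' , ∈rest' , ≤-trans (proj₂ (proj₂ (∈-rowCells⁻ ∈row))) bound

  row-undercuts : ∀ {r' c'} → (r' , c') ∈ rest → ∃[ c ] ((r , c) ∈ rowCells r off (suc a) × c ≤ c')
  row-undercuts ∈rest = suc off , rowCells-first , skewGo-column> (suc r) (suc a) _ z as ∈rest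

𝕊-row₁ : ∀ α {c} → (1 , c) ∈ 𝕊 α → (1 , 1) ∈ 𝕊 α
𝕊-row₁ (zero ∷ α) ∈𝕊 with skewGo-row≥ 2 0 0 1 α ∈𝕊
... | s≤s ()
𝕊-row₁ (suc a ∷ α) _ = here refl

skew⇒generalized : ∀ D → IsDiagram D → IsSkewDiagram D → IsGeneralizedSkewDiagram D
skew⇒generalized D isDiagram (α , D≈𝕊α) =
  isDiagram , GeneralizedSkewShape-≈D D≈𝕊α (skewGo-shape 1 0 0 0 α)

row₁-misses-column₁⇒¬skew : ∀ {D c} → (1 , c) ∈ D → ¬ (1 , 1) ∈ D → ¬ IsSkewDiagram D
row₁-misses-column₁⇒¬skew {c = c} ∈D 11∉D (α , D≈𝕊α) =
  11∉D (Equivalence.from (D≈𝕊α (1 , 1)) (𝕊-row₁ α (Equivalence.to (D≈𝕊α (1 , c)) ∈D)))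

proposition3p6 : (∀ D → IsDiagram D → IsSkewDiagram D → IsGeneralizedSkewDiagram D)
    × (∃[ D ] (IsDiagram D × IsGeneralizedSkewDiagram D × ¬ IsSkewDiagram D))
proposition3p6 =
  skew⇒generalized ,
  ((1 , 2) ∷ [] , diagram , (diagram , GeneralizedSkewShape-singleton 1 2) ,
   row₁-misses-column₁⇒¬skew (here refl) λ { (here ()) ; (there ()) })
  where
  diagram : IsDiagram ((1 , 2) ∷ [])
  diagram = (s≤s z≤n , s≤s z≤n) ∷ []
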